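{- Let $G$ be a finite simple graph with a normal spanning tree $T$ rooted at $r$, such that $G$ has no secant edges with respect to $T$. If $T$ is a whip, then $G$ has a proper $3$-coloring in which all leaves of $T$ receive the same color.
   Context: For a spanning tree $T$ rooted at $r$: $y\le_T x$ means $y$ lies on the $rx$-path of $T$; the level of $x$ is the length of that path; the successors of $x$ are its neighbors of level one more. $T$ is normal in $G$ if for every edge $xy$ of $G$, $x\le_T y$ or $y\le_T x$. Two edges $e,e'$ are secant with respect to $T$ if there is a path $P=v_0\dots v_t$ in $T$ with $v_0=r$, $e=v_lv_m$, $e'=v_pv_q$, $l<m$, $p<q$, $m-l>1$, $q-p>1$, and $l<p<m<q$ or $p<l<q<m$. A star$^0$-like tree is a tree with exactly one vertex (its node) of degree strictly greater than $2$. A whip is a star$^0$-like tree in which the successors of its unique node are leaves. -}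

module Defs where

open import Data.Nat using (ℕ; zero; suc; _+_; _<_; _≤_)
open import Data.Fin using (Fin; toℕ; fromℕ; inject₁) renaming (zero to fz; suc to fs)
open import Data.Bool using (Bool; true; false; if_then_else_)
open import Data.List using (List; map) renaming (allFin to allFinL)
open import Data.Nat.ListAction using (sum)
open import Data.Product using (Σ; ∃; _×_; _,_)
open import Data.Sum using (_⊎_)
open import Relation.Binary.PropositionalEquality using (_≡_; _≢_)
open import Relation.Nullary using (¬_)
open import Function.Definitions using (Injective)

Graph : ℕ → Set
Graph n = Fin n → Fin n → Bool

record IsSimple {n : ℕ} (E : Graph n) : Set where
  field
    sym   : ∀ x y → E x y ≡ true → E y x ≡ true
    irrefl : ∀ x → E x x ≡ false

record Path {n : ℕ} (E : Graph n) (a b : Fin n) : Set where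
  field
    len   : ℕ
    v     : Fin (suc len) → Fin n
    start : v fz ≡ a
    end   : v (fromℕ len) ≡ b
    inj   : Injective _≡_ _≡_ v
    adj   : ∀ (i : Fin len) → E (v (inject₁ i)) (v (fs i)) ≡ true

HasCycle : {n : ℕ} → Graph n → Set
HasCycle {n} E = Σ (Fin n) λ a → Σ (Fin n) λ b → Σ (Path E a b) λ P →
  (2 ≤ Path.len P) × (E b a ≡ true)

Connected : {n : ℕ} → Graph n → Set
Connected {n} E = ∀ (a b : Fin n) → Path E a b

record IsSpanningTree {n : ℕ} (G T : Graph n) : Set where
  field
    simple    : IsSimple T
    subgraph  : ∀ x y → T x y ≡ true → G x y ≡ true
    connected : Connected T
    acyclic   : ¬ HasCycle T

_≤[_,_]_ : {n : ℕ} → Fin n → Graph n → Fin n → Fin n → Set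
y ≤[ T , r ] x = Σ (Path T r x) λ P → Σ (Fin (suc (Path.len P))) λ i → Path.v P i ≡ y

Level : {n : ℕ} → Graph n → Fin n → Fin n → ℕ → Set
Level T r x k = Σ (Path T r x) λ P → Path.len P ≡ k

Successor : {n : ℕ} → Graph n → Fin n → Fin n → Fin n → Set
Successor T r x y = (T x y ≡ true) × ∃ λ k → Level T r x k × Level T r y (suc k)

IsNormal : {n : ℕ} → Graph n → Graph n → Fin n → Set
IsNormal G T r = ∀ x y → G x y ≡ true → (x ≤[ T , r ] y) ⊎ (y ≤[ T , r ] x)

-- G has two secant edges with respect to (T, r)
HasSecant : {n : ℕ} → Graph n → Graph n → Fin n → Set
HasSecant {n} G T r = Σ (Fin n) λ b → Σ (Path T r b) λ P →
  let v = Path.v P in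
  Σ (Fin (suc (Path.len P))) λ l → Σ (Fin (suc (Path.len P))) λ m →
  Σ (Fin (suc (Path.len P))) λ p → Σ (Fin (suc (Path.len P))) λ q →
    (G (v l) (v m) ≡ true) × (G (v p) (v q) ≡ true) ×
    (toℕ l < toℕ m) × (toℕ p < toℕ q) ×
    (suc (toℕ l) < toℕ m) × (suc (toℕ p) < toℕ q) ×
    ((toℕ l < toℕ p × toℕ p < toℕ m × toℕ m < toℕ q) ⊎
     (toℕ p < toℕ l × toℕ l < toℕ q × toℕ q < toℕ m))

degree : {n : ℕ} → Graph n → Fin n → ℕ
degree {n} E x = sum (map (λ y → if E x y then 1 else 0) (allFinL n))

IsLeaf : {n : ℕ} → Graph n → Fin n → Fin n → Set
IsLeaf T r x = (x ≢ r) × (degree T x ≡ 1)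

IsNode : {n : ℕ} → Graph n → Fin n → Set
IsNode {n} T c = (2 < degree T c) × (∀ (x : Fin n) → 2 < degree T x → x ≡ c)

IsWhip : {n : ℕ} → Graph n → Fin n → Set
IsWhip {n} T r = Σ (Fin n) λ c → IsNode T c × (∀ y → Successor T r c y → IsLeaf T r y)

IsProper3Coloring : {n : ℕ} → Graph n → (Fin n → Fin 3) → Set
IsProper3Coloring G col = ∀ x y → G x y ≡ true → col x ≢ col y

-- Since T is normal, every edge of G joins a vertex to one of its T-ancestors. A whip with
-- node c consists of the spine (the root path of c), the children of c, which are leaves,
-- and the remaining branch vertices, which all lie on one root path ending in a leaf: a fork
-- among them would be a second vertex of degree at least 3. Merging the children of c into a
-- single point after c, the G-edges along the spine and along the branch path become chords
-- of two paths, and the absence of secant edges says exactly that these chords do not cross.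
-- A path with non-crossing chords can be properly 3-coloured with any two distinct colours at
-- its ends. Colour the spine from 0 at r to 1 just after c and the branch from 0 at r to 1 at
-- its end; then every leaf of T gets colour 1.

module Submission where

open import Defs
open import Data.Bool using (true; if_then_else_)
import Data.Bool.Properties as Bool
open import Data.Empty using (⊥; ⊥-elim)
open import Data.Fin using (Fin; toℕ; fromℕ; fromℕ<; inject₁) renaming (zero to fz; suc to fs)
open import Data.Fin.Properties using (_≟_; any?; toℕ-injective; toℕ-fromℕ; toℕ-fromℕ<; toℕ-inject₁; toℕ<n)
open import Data.List using (List; []; _∷_; length; tabulate)
open import Data.List.Properties using (map-tabulate)
open import Data.List.Relation.Unary.All using (All; []; _∷_) renaming (zipWith to All-zipWith; map to All-map)
open import Data.List.Relation.Unary.AllPairs using ([]; _∷_)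
open import Data.List.Relation.Unary.Unique.Propositional using (Unique)
open import Data.Nat using (ℕ; zero; suc; _+_; _∸_; _⊓_; _<_; _≤_; z≤n; s≤s; _≤?_)
open import Data.Nat.ListAction using (sum)
open import Data.Nat.Properties hiding (_≟_)
import Data.Nat.Properties as ℕ
open import Data.Product using (Σ; ∃; _×_; _,_; proj₁; proj₂)
open import Data.Sum using (_⊎_; inj₁; inj₂)
open import Function using (_∘_)
open import Relation.Binary.PropositionalEquality
  using (_≡_; _≢_; refl; sym; trans; cong; subst; subst₂; module ≡-Reasoning)
open import Relation.Nullary using (¬_; Dec; does; yes; no; contradiction; ¬?)
open import Relation.Nullary.Decidable using (_×-dec_; _⊎-dec_)
open import Relation.Unary using (Pred; Decidable)
open import Algebra.Properties.CommutativeSemigroup +-commutativeSemigroup using (x∙yz≈y∙xz)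

-- Colouring a path with non-crossing chords

greatest-below? : ∀ {p} {P : Pred ℕ p} → Decidable P → ∀ lo hi →
  (∃ λ y → lo ≤ y × y < hi × P y × (∀ {z} → y < z → z < hi → ¬ P z))
  ⊎ (∀ {z} → lo ≤ z → z < hi → ¬ P z)
greatest-below? P? lo zero = inj₂ λ _ ()
greatest-below? {P = P} P? lo (suc hi) with lo ≤? hi | P? hi
... | no lo≰hi | _ = inj₂ λ lo≤z z<1+hi → contradiction (≤-trans lo≤z (≤-pred z<1+hi)) lo≰hi
... | yes lo≤hi | yes Phi = inj₁ (hi , lo≤hi , ≤-refl , Phi , λ hi<z z<1+hi → contradiction hi<z (≤⇒≯ (≤-pred z<1+hi)))
... | yes _ | no ¬Phi with greatest-below? P? lo hi
...   | inj₁ (y , lo≤y , y<hi , Py , above) =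
        inj₁ (y , lo≤y , m≤n⇒m≤1+n y<hi , Py , λ y<z z<1+hi → extend (λ z<hi → above y<z z<hi) z<1+hi)
  where
  extend : ∀ {z} → (z < hi → ¬ P z) → z < suc hi → ¬ P z
  extend below z<1+hi with m≤n⇒m<n∨m≡n (≤-pred z<1+hi)
  ... | inj₁ z<hi = below z<hi
  ... | inj₂ refl = ¬Phi
...   | inj₂ none = inj₂ λ lo≤z z<1+hi → case (m≤n⇒m<n∨m≡n (≤-pred z<1+hi)) lo≤z
  where
  case : ∀ {z} → z < hi ⊎ z ≡ hi → lo ≤ z → ¬ P z
  case (inj₁ z<hi) lo≤z = none lo≤z z<hi
  case (inj₂ refl) _ = ¬Phi

splice : {A : Set} → ℕ → (ℕ → A) → (ℕ → A) → ℕ → A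
splice k f g x with x ≤? k
... | yes _ = f x
... | no _ = g x

module _ {A : Set} {k : ℕ} {f g : ℕ → A} where

  splice-≤ : ∀ {x} → x ≤ k → splice k f g x ≡ f x
  splice-≤ {x} x≤k with x ≤? k
  ... | yes _ = refl
  ... | no x≰k = contradiction x≤k x≰k

  splice-> : ∀ {x} → k < x → splice k f g x ≡ g x
  splice-> {x} k<x with x ≤? k
  ... | yes x≤k = contradiction x≤k (<⇒≱ k<x)
  ... | no _ = refl

  splice-≥ : f k ≡ g k → ∀ {x} → k ≤ x → splice k f g x ≡ g x
  splice-≥ fk≡gk k≤x with m≤n⇒m<n∨m≡n k≤x
  ... | inj₁ k<x = splice-> k<x
  ... | inj₂ refl = trans (splice-≤ ≤-refl) fk≡gk

another : (a b : Fin 3) → ∃ λ c → c ≢ a × c ≢ b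
another fz fz = fs fz , (λ ()) , (λ ())
another fz (fs fz) = fs (fs fz) , (λ ()) , (λ ())
another fz (fs (fs fz)) = fs fz , (λ ()) , (λ ())
another (fs fz) fz = fs (fs fz) , (λ ()) , (λ ())
another (fs fz) (fs fz) = fz , (λ ()) , (λ ())
another (fs fz) (fs (fs fz)) = fz , (λ ()) , (λ ())
another (fs (fs fz)) fz = fs fz , (λ ()) , (λ ())
another (fs (fs fz)) (fs fz) = fz , (λ ()) , (λ ())
another (fs (fs fz)) (fs (fs fz)) = fz , (λ ()) , (λ ())

NonCrossing : ∀ {h} → (ℕ → ℕ → Set h) → Set h
NonCrossing H = ∀ {l p m q} → l < p → p < m → m < q → suc l < m → H l m → H p q → ⊥

ProperOn : ∀ {h} → (ℕ → ℕ → Set h) → (ℕ → Fin 3) → ℕ → ℕ → Set h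
ProperOn H col a b = ∀ {x y} → a ≤ x → x < y → y ≤ b → H x y → col x ≢ col y

module _ {h} {H : ℕ → ℕ → Set h} where

  splice-proper : ∀ {a k b c₁ c₂} → c₁ k ≡ c₂ k → ProperOn H c₁ a k → ProperOn H c₂ k b →
    (∀ {x y} → a ≤ x → x < k → k < y → y ≤ b → H x y → splice k c₁ c₂ x ≢ splice k c₁ c₂ y) →
    ProperOn H (splice k c₁ c₂) a b
  splice-proper {a} {k} {b} {c₁} {c₂} agree proper₁ proper₂ straddling {x} {y} a≤x x<y y≤b Hxy
    with ≤-<-connex y k | ≤-<-connex k x
  ... | inj₁ y≤k | _ = subst₂ _≢_ (sym (splice-≤ (<⇒≤ (<-≤-trans x<y y≤k)))) (sym (splice-≤ y≤k))
                         (proper₁ a≤x x<y y≤k Hxy)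
  ... | inj₂ _ | inj₁ k≤x = subst₂ _≢_ (sym (splice-≥ agree k≤x)) (sym (splice-≥ agree (<⇒≤ (≤-<-trans k≤x x<y))))
                              (proper₂ k≤x x<y y≤b Hxy)
  ... | inj₂ k<y | inj₂ x<k = straddling a≤x x<k k<y y≤b Hxy

  greatest-chord : ∀ {a b} → (∀ j → Dec (H a j)) → suc a < b →
    ∃ λ k → a < k × k < b × (k ≡ suc a ⊎ (suc a < k × H a k)) × (∀ {z} → k < z → z < b → ¬ H a z)
  greatest-chord {a} {b} Ha? 1+a<b with greatest-below? Ha? (suc (suc a)) b
  ... | inj₁ (k , 2+a≤k , k<b , Hak , above) = k , <-trans (n<1+n a) 2+a≤k , k<b , inj₂ (2+a≤k , Hak) , above
  ... | inj₂ none = suc a , n<1+n a , 1+a<b , inj₁ refl , none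

  module _ (H? : ∀ i j → Dec (H i j)) (noncrossing : NonCrossing H) where

    -- Split [a, b] at the farthest chord a–k (or at a + 1) and use a third colour at k: a chord
    -- across k would cross a–k, except a–b itself, whose ends get the distinct colours α and β.
    colour-segment : ∀ {a b} → a < b → ∀ {α β} → α ≢ β →
      Σ (ℕ → Fin 3) λ col → col a ≡ α × col b ≡ β × ProperOn H col a b
    colour-segment {a} {b} a<b = go b a<b (m≤n+m b a)
      where
      go : ∀ fuel {a b} → a < b → b ≤ a + fuel → ∀ {α β} → α ≢ β →
        Σ (ℕ → Fin 3) λ col → col a ≡ α × col b ≡ β × ProperOn H col a b
      go zero {a} a<b b≤a+0 _ = contradiction (subst (_ ≤_) (+-identityʳ a) b≤a+0) (<⇒≱ a<b)
      go (suc fuel) {a} {b} a<b b≤ {α} {β} α≢β with ≤-<-connex b (suc a)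
      ... | inj₁ b≤1+a = col , colour-left ≤-refl , colour-right a<b , proper
        where
        col : ℕ → Fin 3
        col = splice a (λ _ → α) (λ _ → β)
        colour-left : ∀ {x} → x ≤ a → col x ≡ α
        colour-left = splice-≤ {k = a} {f = λ _ → α} {g = λ _ → β}
        colour-right : ∀ {x} → a < x → col x ≡ β
        colour-right = splice-> {k = a} {f = λ _ → α} {g = λ _ → β}
        proper : ProperOn H col a b
        proper a≤x x<y y≤b _ = subst₂ _≢_ (sym (colour-left (≤-pred (<-≤-trans x<y (≤-trans y≤b b≤1+a)))))
                                 (sym (colour-right (≤-<-trans a≤x x<y))) α≢β
      ... | inj₂ 1+a<b with greatest-chord (H? a) 1+a<b | another α β
      ...   | k , a<k , k<b , short-or-chord , beyond | γ , γ≢α , γ≢β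
              with go fuel a<k (≤-pred (≤-trans k<b (subst (b ≤_) (+-suc a fuel) b≤))) (γ≢α ∘ sym)
                 | go fuel k<b (≤-trans b≤ (subst (_≤ k + fuel) (sym (+-suc a fuel)) (+-monoˡ-≤ fuel a<k))) γ≢β
      ...     | c₁ , c₁a≡α , c₁k≡γ , proper₁ | c₂ , c₂k≡γ , c₂b≡β , proper₂ =
                splice k c₁ c₂ , col-a , col-b , splice-proper (trans c₁k≡γ (sym c₂k≡γ)) proper₁ proper₂ straddling
        where
        col-a : splice k c₁ c₂ a ≡ α
        col-a = trans (splice-≤ (<⇒≤ a<k)) c₁a≡α
        col-b : splice k c₁ c₂ b ≡ β
        col-b = trans (splice-> k<b) c₂b≡β
        straddling : ∀ {x y} → a ≤ x → x < k → k < y → y ≤ b → H x y → splice k c₁ c₂ x ≢ splice k c₁ c₂ y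
        straddling {x} {y} a≤x x<k k<y y≤b Hxy with m≤n⇒m<n∨m≡n a≤x | m≤n⇒m<n∨m≡n y≤b
        ... | inj₁ a<x | _ = ⊥-elim (crossing short-or-chord)
          where
          crossing : k ≡ suc a ⊎ (suc a < k × H a k) → ⊥
          crossing (inj₁ k≡1+a) = contradiction (subst (x <_) k≡1+a x<k) (≤⇒≯ a<x)
          crossing (inj₂ (1+a<k , Hak)) = noncrossing a<x x<k k<y 1+a<k Hak Hxy
        ... | inj₂ refl | inj₁ y<b = ⊥-elim (beyond k<y y<b Hxy)
        ... | inj₂ refl | inj₂ refl = λ same → α≢β (trans (sym col-a) (trans same col-b))

-- Paths indexed by ℕ

clamp : (L t : ℕ) → Fin (suc L)
clamp L zero = fz
clamp zero (suc t) = fz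
clamp (suc L) (suc t) = fs (clamp L t)

clamp-toℕ : ∀ L (i : Fin (suc L)) → clamp L (toℕ i) ≡ i
clamp-toℕ L fz = refl
clamp-toℕ (suc L) (fs i) = cong fs (clamp-toℕ L i)

toℕ-clamp : ∀ {L t} → t ≤ L → toℕ (clamp L t) ≡ t
toℕ-clamp {t = zero} _ = refl
toℕ-clamp {suc L} {suc t} (s≤s t≤L) = cong suc (toℕ-clamp t≤L)

module _ {n : ℕ} {E : Graph n} where

  -- Indices beyond the end of the path are clamped to its last vertex.
  at : ∀ {a b} → Path E a b → ℕ → Fin n
  at P t = Path.v P (clamp (Path.len P) t)

  pathFrom : ∀ {a b} (g : ℕ → Fin n) (L : ℕ) →
    (∀ {s t} → s ≤ L → t ≤ L → g s ≡ g t → s ≡ t) →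
    (∀ {s} → s < L → E (g s) (g (suc s)) ≡ true) →
    g 0 ≡ a → g L ≡ b → Path E a b
  pathFrom g L inj adj g0≡a gL≡b = record
    { len = L
    ; v = λ i → g (toℕ i)
    ; start = g0≡a
    ; end = trans (cong g (toℕ-fromℕ L)) gL≡b
    ; inj = λ {i} {j} eq → toℕ-injective (inj (≤-pred (toℕ<n i)) (≤-pred (toℕ<n j)) eq)
    ; adj = λ i → subst (λ s → E (g s) (g (suc (toℕ i))) ≡ true) (sym (toℕ-inject₁ i)) (adj (toℕ<n i))
    }

  module _ {a b : Fin n} (P : Path E a b) where
    private
      L : ℕ
      L = Path.len P

    at-toℕ : (i : Fin (suc L)) → at P (toℕ i) ≡ Path.v P i
    at-toℕ i = cong (Path.v P) (clamp-toℕ L i)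

    at-start : at P 0 ≡ a
    at-start = Path.start P

    at-end : at P L ≡ b
    at-end = trans (cong (at P) (sym (toℕ-fromℕ L))) (trans (at-toℕ (fromℕ L)) (Path.end P))

    at-injective : ∀ {s t} → s ≤ L → t ≤ L → at P s ≡ at P t → s ≡ t
    at-injective s≤L t≤L eq = trans (sym (toℕ-clamp s≤L)) (trans (cong toℕ (Path.inj P eq)) (toℕ-clamp t≤L))

    at-adjacent : ∀ {s} → s < L → E (at P s) (at P (suc s)) ≡ true
    at-adjacent {s} s<L = subst₂ (λ i j → E (Path.v P i) (Path.v P j) ≡ true) inject≡ suc≡ (Path.adj P i)
      where
      i : Fin L
      i = fromℕ< s<L
      inject≡ : inject₁ i ≡ clamp L s
      inject≡ = trans (sym (clamp-toℕ L (inject₁ i))) (cong (clamp L) (trans (toℕ-inject₁ i) (toℕ-fromℕ< s<L)))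
      suc≡ : fs i ≡ clamp L (suc s)
      suc≡ = trans (sym (clamp-toℕ L (fs i))) (cong (λ t → clamp L (suc t)) (toℕ-fromℕ< s<L))

    prefix : ∀ k → k ≤ L → Path E a (at P k)
    prefix k k≤L = pathFrom (at P) k
      (λ s≤k t≤k → at-injective (≤-trans s≤k k≤L) (≤-trans t≤k k≤L))
      (λ s<k → at-adjacent (<-≤-trans s<k k≤L))
      at-start refl

    slice : ∀ {u v} k l → k + l ≤ L → at P k ≡ u → at P (k + l) ≡ v → Path E u v
    slice k l k+l≤L start end = pathFrom (λ t → at P (k + t)) l
      (λ s≤l t≤l eq → +-cancelˡ-≡ k _ _ (at-injective (bound s≤l) (bound t≤l) eq))
      (λ {s} s<l → subst (λ u → E (at P (k + s)) (at P u) ≡ true) (sym (+-suc k s))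
                     (at-adjacent (<-≤-trans (subst (_≤ k + l) (+-suc k s) (+-monoʳ-≤ k s<l)) k+l≤L)))
      (trans (cong (at P) (+-identityʳ k)) start) end
      where
      bound : ∀ {t} → t ≤ l → k + t ≤ L
      bound t≤l = ≤-trans (+-monoʳ-≤ k t≤l) k+l≤L

    at-slice : ∀ {u v} k l (k+l≤L : k + l ≤ L) (start : at P k ≡ u) (end : at P (k + l) ≡ v) →
      ∀ {t} → t ≤ l → at (slice k l k+l≤L start end) t ≡ at P (k + t)
    at-slice k l _ _ _ t≤l = cong (λ u → at P (k + u)) (toℕ-clamp t≤l)

-- Degrees

erase : ∀ {n} → Fin n → (Fin n → ℕ) → Fin n → ℕ
erase y h z = if does (z ≟ y) then 0 else h z

erase-≢ : ∀ {n} {y z : Fin n} (h : Fin n → ℕ) → z ≢ y → erase y h z ≡ h z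
erase-≢ {y = y} {z} h z≢y with z ≟ y
... | yes z≡y = contradiction z≡y z≢y
... | no _ = refl

sum-tabulate-erase : ∀ {n} (h : Fin n → ℕ) y → sum (tabulate h) ≡ h y + sum (tabulate (erase y h))
sum-tabulate-erase h fz = refl
sum-tabulate-erase h (fs y) = begin
  h fz + sum (tabulate (λ z → h (fs z)))                        ≡⟨ cong (h fz +_) (sum-tabulate-erase (λ z → h (fs z)) y) ⟩
  h fz + (h (fs y) + sum (tabulate (erase y (λ z → h (fs z))))) ≡⟨ x∙yz≈y∙xz (h fz) (h (fs y)) _ ⟩
  h (fs y) + (h fz + sum (tabulate (erase y (λ z → h (fs z)))))  ∎
  where open ≡-Reasoning

length≤sum-tabulate : ∀ {n} (h : Fin n → ℕ) {ys : List (Fin n)} →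
  Unique ys → All (λ y → 1 ≤ h y) ys → length ys ≤ sum (tabulate h)
length≤sum-tabulate h [] [] = z≤n
length≤sum-tabulate h {y ∷ ys} (y∉ys ∷ unique) (1≤hy ∷ positive) =
  subst (suc (length ys) ≤_) (sym (sum-tabulate-erase h y))
    (+-mono-≤ 1≤hy (length≤sum-tabulate (erase y h) unique
      (All-zipWith (λ (y≢z , 1≤hz) → subst (1 ≤_) (sym (erase-≢ h (λ z≡y → y≢z (sym z≡y)))) 1≤hz) (y∉ys , positive))))

neighbours≤degree : ∀ {n} (E : Graph n) x {ys : List (Fin n)} →
  Unique ys → All (λ y → E x y ≡ true) ys → length ys ≤ degree E x
neighbours≤degree {n} E x unique adjacent =
  subst (_ ≤_) (sym (cong sum (map-tabulate (λ y → y) indicator)))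
    (length≤sum-tabulate indicator unique (All-map one adjacent))
  where
  indicator : Fin n → ℕ
  indicator y = if E x y then 1 else 0
  one : ∀ {y} → E x y ≡ true → 1 ≤ indicator y
  one Exy rewrite Exy = s≤s z≤n

module _ {n : ℕ} (E : Graph n) {x : Fin n} where

  two-neighbours⇒2≤degree : ∀ {y₁ y₂} → y₁ ≢ y₂ → E x y₁ ≡ true → E x y₂ ≡ true → 2 ≤ degree E x
  two-neighbours⇒2≤degree y₁≢y₂ e₁ e₂ =
    neighbours≤degree E x ((y₁≢y₂ ∷ []) ∷ [] ∷ []) (e₁ ∷ e₂ ∷ [])

  three-neighbours⇒3≤degree : ∀ {y₁ y₂ y₃} → y₁ ≢ y₂ → y₁ ≢ y₃ → y₂ ≢ y₃ →
    E x y₁ ≡ true → E x y₂ ≡ true → E x y₃ ≡ true → 3 ≤ degree E x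
  three-neighbours⇒3≤degree y₁≢y₂ y₁≢y₃ y₂≢y₃ e₁ e₂ e₃ =
    neighbours≤degree E x ((y₁≢y₂ ∷ y₁≢y₃ ∷ []) ∷ (y₂≢y₃ ∷ []) ∷ [] ∷ []) (e₁ ∷ e₂ ∷ e₃ ∷ [])

-- Cycles and paths in forests

3≤[1+i∸k]+[1+j∸k] : ∀ {k i j} → k ≤ i → k ≤ j → (k ≡ i → k ≡ j → ⊥) → 3 ≤ (suc i ∸ k) + (suc j ∸ k)
3≤[1+i∸k]+[1+j∸k] {zero} {zero} {zero} _ _ not-both = ⊥-elim (not-both refl refl)
3≤[1+i∸k]+[1+j∸k] {zero} {zero} {suc j} _ _ _ = s≤s (s≤s (s≤s z≤n))
3≤[1+i∸k]+[1+j∸k] {zero} {suc i} {j} _ _ _ = s≤s (s≤s (subst (1 ≤_) (sym (+-suc i j)) (s≤s z≤n)))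
3≤[1+i∸k]+[1+j∸k] {suc k} {suc i} {suc j} (s≤s k≤i) (s≤s k≤j) not-both =
  3≤[1+i∸k]+[1+j∸k] k≤i k≤j (λ k≡i k≡j → not-both (cong suc k≡i) (cong suc k≡j))

module _ {n : ℕ} {E : Graph n} (E-sym : ∀ x y → E x y ≡ true → E y x ≡ true) where

  at-adjacent⁻ : ∀ {a b} (P : Path E a b) {s} → s < Path.len P → E (at P (suc s)) (at P s) ≡ true
  at-adjacent⁻ P s<L = E-sym _ _ (at-adjacent P s<L)

  interior⇒2≤degree : ∀ {a b} (P : Path E a b) {t} → 0 < t → t < Path.len P → 2 ≤ degree E (at P t)
  interior⇒2≤degree P {suc t} _ 1+t<L =
    two-neighbours⇒2≤degree E distinct (at-adjacent⁻ P t<L) (at-adjacent P 1+t<L)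
    where
    t<L : t < Path.len P
    t<L = <-trans (n<1+n t) 1+t<L
    distinct : at P t ≢ at P (suc (suc t))
    distinct eq = <-irrefl (at-injective P (<⇒≤ t<L) 1+t<L eq) (<-trans (n<1+n t) (n<1+n (suc t)))

  internally-disjoint⇒cycle : ∀ {u v} (P Q : Path E u v) → 1 ≤ Path.len Q → 3 ≤ Path.len P + Path.len Q →
    (∀ {s t} → 0 < s → s < Path.len P → 0 < t → t < Path.len Q → at P s ≢ at Q t) → HasCycle E
  internally-disjoint⇒cycle P Q 1≤B 3≤K disjoint = g 0 , g L , pathFrom g L inj adj refl refl , 2≤L , closing
    where
    A B K L : ℕ
    A = Path.len P
    B = Path.len Q
    K = A + B
    L = K ∸ 1
    g : ℕ → Fin n
    g = splice A (at P) (λ t → at Q (K ∸ t))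
    K∸A≡B : K ∸ A ≡ B
    K∸A≡B = m+n∸m≡n A B
    g-left : ∀ {t} → t ≤ A → g t ≡ at P t
    g-left = splice-≤
    g-right : ∀ {t} → A ≤ t → g t ≡ at Q (K ∸ t)
    g-right = splice-≥ (trans (at-end P) (trans (sym (at-end Q)) (cong (at Q) (sym K∸A≡B))))
    L<K : L < K
    L<K = subst (L <_) (m∸n+n≡m (≤-trans (s≤s z≤n) 3≤K)) (m<m+n L (s≤s z≤n))
    A≤L : A ≤ L
    A≤L = subst (_≤ L) (m+n∸n≡m A 1) (∸-monoˡ-≤ 1 (+-monoʳ-≤ A 1≤B))
    2≤L : 2 ≤ L
    2≤L = ∸-monoˡ-≤ 1 3≤K
    K∸t≤B : ∀ {t} → A ≤ t → K ∸ t ≤ B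
    K∸t≤B {t} A≤t = subst (K ∸ t ≤_) K∸A≡B (∸-monoʳ-≤ K A≤t)
    K∸t<B : ∀ {t} → A < t → t ≤ L → K ∸ t < B
    K∸t<B {t} A<t t≤L = subst (K ∸ t <_) K∸A≡B (∸-monoʳ-< A<t (<⇒≤ (≤-<-trans t≤L L<K)))
    mixed : ∀ {s t} → s ≤ A → A < t → t ≤ L → at P s ≢ at Q (K ∸ t)
    mixed {zero} {t} _ A<t t≤L eq =
      <-irrefl (at-injective Q z≤n (K∸t≤B (<⇒≤ A<t)) (trans (at-start Q) (trans (sym (at-start P)) eq)))
               (m<n⇒0<n∸m (≤-<-trans t≤L L<K))
    mixed {suc s} {t} 1+s≤A A<t t≤L eq with m≤n⇒m<n∨m≡n 1+s≤A
    ... | inj₁ 1+s<A = disjoint (s≤s z≤n) 1+s<A (m<n⇒0<n∸m (≤-<-trans t≤L L<K)) (K∸t<B A<t t≤L) eq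
    ... | inj₂ refl = <-irrefl (sym (at-injective Q ≤-refl (<⇒≤ (K∸t<B A<t t≤L)) (trans (at-end Q) (trans (sym (at-end P)) eq))))
                        (K∸t<B A<t t≤L)
    inj : ∀ {s t} → s ≤ L → t ≤ L → g s ≡ g t → s ≡ t
    inj {s} {t} s≤L t≤L eq with ≤-<-connex s A | ≤-<-connex t A
    ... | inj₁ s≤A | inj₁ t≤A = at-injective P s≤A t≤A (trans (sym (g-left s≤A)) (trans eq (g-left t≤A)))
    ... | inj₂ A<s | inj₂ A<t = ∸-cancelˡ-≡ (<⇒≤ (≤-<-trans s≤L L<K)) (<⇒≤ (≤-<-trans t≤L L<K))
        (at-injective Q (K∸t≤B (<⇒≤ A<s)) (K∸t≤B (<⇒≤ A<t))
          (trans (sym (g-right (<⇒≤ A<s))) (trans eq (g-right (<⇒≤ A<t)))))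
    ... | inj₁ s≤A | inj₂ A<t = ⊥-elim (mixed s≤A A<t t≤L (trans (sym (g-left s≤A)) (trans eq (g-right (<⇒≤ A<t)))))
    ... | inj₂ A<s | inj₁ t≤A = ⊥-elim (mixed t≤A A<s s≤L (trans (sym (g-left t≤A)) (trans (sym eq) (g-right (<⇒≤ A<s)))))
    adj : ∀ {t} → t < L → E (g t) (g (suc t)) ≡ true
    adj {t} t<L with ≤-<-connex (suc t) A
    ... | inj₁ 1+t≤A = subst₂ (λ x y → E x y ≡ true) (sym (g-left (<⇒≤ 1+t≤A))) (sym (g-left 1+t≤A)) (at-adjacent P 1+t≤A)
    ... | inj₂ A<1+t = subst₂ (λ x y → E x y ≡ true)
          (trans (cong (at Q) K∸t≡1+j) (sym (g-right A≤t))) (sym (g-right (≤-trans A≤t (n≤1+n t))))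
          (at-adjacent⁻ Q (subst (_≤ B) (sym K∸t≡1+j) (K∸t≤B A≤t)))
      where
      A≤t = ≤-pred A<1+t
      K∸t≡1+j : suc (K ∸ suc t) ≡ K ∸ t
      K∸t≡1+j = sym (+-∸-assoc 1 (<-trans t<L L<K))
    closing : E (g L) (g 0) ≡ true
    closing = subst₂ (λ x y → E x y ≡ true)
      (trans (cong (at Q) (sym (m∸[m∸n]≡n (≤-trans (s≤s z≤n) 3≤K)))) (sym (g-right A≤L)))
      (trans (at-start Q) (trans (sym (at-start P)) (sym (g-left z≤n))))
      (at-adjacent⁻ Q 1≤B)

  rejoin⇒cycle : ∀ {a b b′} (P : Path E a b) (Q : Path E a b′) {k i j} → k ≤ i → k ≤ j →
    suc i ≤ Path.len P → suc j ≤ Path.len Q → (∀ {t} → t ≤ k → at P t ≡ at Q t) →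
    at P (suc i) ≡ at Q (suc j) → at P i ≢ at Q j →
    (∀ {z} → k < z → z < suc i → ¬ (∃ λ s → s < suc j × at Q s ≡ at P z)) → HasCycle E
  rejoin⇒cycle P Q {k} {i} {j} k≤i k≤j 1+i≤ 1+j≤ prefix meet apart off-Q =
    internally-disjoint⇒cycle P′ Q′ (m<n⇒0<n∸m (s≤s k≤j))
      (3≤[1+i∸k]+[1+j∸k] k≤i k≤j λ { refl refl → apart (prefix ≤-refl) }) disjoint
    where
    lP lQ : ℕ
    lP = suc i ∸ k
    lQ = suc j ∸ k
    k+lP≡1+i : k + lP ≡ suc i
    k+lP≡1+i = m+[n∸m]≡n (m≤n⇒m≤1+n k≤i)
    k+lQ≡1+j : k + lQ ≡ suc j
    k+lQ≡1+j = m+[n∸m]≡n (m≤n⇒m≤1+n k≤j)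
    boundP : k + lP ≤ Path.len P
    boundP = subst (_≤ Path.len P) (sym k+lP≡1+i) 1+i≤
    boundQ : k + lQ ≤ Path.len Q
    boundQ = subst (_≤ Path.len Q) (sym k+lQ≡1+j) 1+j≤
    endP : at P (k + lP) ≡ at P (suc i)
    endP = cong (at P) k+lP≡1+i
    startQ : at Q k ≡ at P k
    startQ = sym (prefix ≤-refl)
    endQ : at Q (k + lQ) ≡ at P (suc i)
    endQ = trans (cong (at Q) k+lQ≡1+j) (sym meet)
    P′ Q′ : Path E (at P k) (at P (suc i))
    P′ = slice P k lP boundP refl endP
    Q′ = slice Q k lQ boundQ startQ endQ
    disjoint : ∀ {s t} → 0 < s → s < lP → 0 < t → t < lQ → at P′ s ≢ at Q′ t
    disjoint {s} {t} 0<s s<lP _ t<lQ eq = off-Q (m<m+n k 0<s) (subst (k + s <_) k+lP≡1+i (+-monoʳ-< k s<lP))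
      ( k + t , subst (k + t <_) k+lQ≡1+j (+-monoʳ-< k t<lQ)
      , trans (sym (at-slice Q k lQ boundQ startQ endQ (<⇒≤ t<lQ))) (trans (sym eq) (at-slice P k lP boundP refl endP (<⇒≤ s<lP))))

module TreePaths {n : ℕ} {T : Graph n} (T-simple : IsSimple T) (acyclic : ¬ HasCycle T) where

  paths-agree : ∀ {a b b′} (P : Path T a b) (Q : Path T a b′) {i j} → i ≤ Path.len P → j ≤ Path.len Q →
    at P i ≡ at Q j → i ≡ j × (∀ {t} → t ≤ i → at P t ≡ at Q t)
  paths-agree P Q = go _ ≤-refl
    where
    starts : at P 0 ≡ at Q 0
    starts = trans (at-start P) (sym (at-start Q))
    go : ∀ k {i j} → i ≤ k → i ≤ Path.len P → j ≤ Path.len Q →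
      at P i ≡ at Q j → i ≡ j × (∀ {t} → t ≤ i → at P t ≡ at Q t)
    go _ {zero} _ _ j≤ eq = sym (at-injective Q j≤ z≤n (trans (sym eq) starts)) , λ { z≤n → starts }
    go _ {suc i} {zero} _ 1+i≤ _ eq = contradiction (at-injective P 1+i≤ z≤n (trans eq (sym starts))) λ ()
    go (suc k) {suc i} {suc j} (s≤s i≤k) 1+i≤ 1+j≤ eq with at P i ≟ at Q j
    ... | no neq with greatest-below? (λ t → anyUpTo? (λ s → at Q s ≟ at P t) (suc j)) 0 (suc i)
    ...   | inj₂ none = ⊥-elim (none z≤n (s≤s z≤n) (0 , s≤s z≤n , sym starts))
    ...   | inj₁ (l , _ , l<1+i , (_ , s≤s l≤j , Ql≡Pl) , off-Q)
            with go k (≤-trans (≤-pred l<1+i) i≤k) (≤-trans (<⇒≤ l<1+i) 1+i≤) (≤-trans l≤j (≤-trans (n≤1+n j) 1+j≤)) (sym Ql≡Pl)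
    ...     | refl , prefix =
              ⊥-elim (acyclic (rejoin⇒cycle (IsSimple.sym T-simple) P Q (≤-pred l<1+i) l≤j 1+i≤ 1+j≤ prefix eq neq off-Q))
    go (suc k) {suc i} {suc j} (s≤s i≤k) 1+i≤ 1+j≤ eq | yes eq′ with go k i≤k (≤-trans (n≤1+n i) 1+i≤) (≤-trans (n≤1+n j) 1+j≤) eq′
    ... | refl , agree = refl , extend
      where
      extend : ∀ {t} → t ≤ suc i → at P t ≡ at Q t
      extend t≤1+i with m≤n⇒m<n∨m≡n t≤1+i
      ... | inj₁ t<1+i = agree (≤-pred t<1+i)
      ... | inj₂ refl = eq

  divergence : ∀ {a b b′} (P : Path T a b) (Q : Path T a b′) →
    ∃ λ d → d ≤ Path.len P × d ≤ Path.len Q × at P d ≡ at Q d ×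
            (∀ {z s} → d < z → z ≤ Path.len P → s ≤ Path.len Q → at P z ≢ at Q s)
  divergence P Q with greatest-below? (λ t → at P t ≟ at Q t) 0 (suc (Path.len P ⊓ Path.len Q))
  ... | inj₂ none = ⊥-elim (none z≤n (s≤s z≤n) (trans (at-start P) (sym (at-start Q))))
  ... | inj₁ (d , _ , s≤s d≤min , Pd≡Qd , above) =
        d , ≤-trans d≤min (m⊓n≤m _ _) , ≤-trans d≤min (m⊓n≤n _ _) , Pd≡Qd , off-Q
    where
    off-Q : ∀ {z s} → d < z → z ≤ Path.len P → s ≤ Path.len Q → at P z ≢ at Q s
    off-Q d<z z≤ s≤ Pz≡Qs with paths-agree P Q z≤ s≤ Pz≡Qs
    ... | refl , _ = above d<z (s≤s (⊓-glb z≤ s≤)) Pz≡Qs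

  fork⇒3≤degree : ∀ {a b b′} (P : Path T a b) (Q : Path T a b′) {d} → 0 < d →
    d < Path.len P → d < Path.len Q → at P d ≡ at Q d → at P (suc d) ≢ at Q (suc d) → 3 ≤ degree T (at P d)
  fork⇒3≤degree P Q {suc d} _ 1+d<P 1+d<Q Pd≡Qd diverge =
    three-neighbours⇒3≤degree T back≢forth back≢other diverge
      (at-adjacent⁻ (IsSimple.sym T-simple) P d<P) (at-adjacent P 1+d<P)
      (subst (λ x → T x (at Q (suc (suc d))) ≡ true) (sym Pd≡Qd) (at-adjacent Q 1+d<Q))
    where
    d<P : d < Path.len P
    d<P = <-trans (n<1+n d) 1+d<P
    d<Q : d < Path.len Q
    d<Q = <-trans (n<1+n d) 1+d<Q
    d<2+d : d < suc (suc d)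
    d<2+d = <-trans (n<1+n d) (n<1+n (suc d))
    back≢forth : at P d ≢ at P (suc (suc d))
    back≢forth eq = <-irrefl (at-injective P (<⇒≤ d<P) 1+d<P eq) d<2+d
    back≢other : at P d ≢ at Q (suc (suc d))
    back≢other eq = <-irrefl (at-injective Q (<⇒≤ d<Q) 1+d<Q
      (trans (sym (proj₂ (paths-agree P Q (<⇒≤ 1+d<P) (<⇒≤ 1+d<Q) Pd≡Qd) (n≤1+n d))) eq)) d<2+d

-- Colouring along a whip

maximum? : ∀ {n p} {P : Pred (Fin n) p} → Decidable P → (f : Fin n → ℕ) →
  (∃ λ w → P w × (∀ x → P x → f x ≤ f w)) ⊎ (∀ x → ¬ P x)
maximum? {zero} P? f = inj₂ λ ()
maximum? {suc n} P? f with maximum? (λ x → P? (fs x)) (λ x → f (fs x)) | P? fz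
... | inj₂ none | no ¬P0 = inj₂ λ { fz → ¬P0 ; (fs x) → none x }
... | inj₂ none | yes P0 = inj₁ (fz , P0 , λ { fz _ → ≤-refl ; (fs x) Px → contradiction Px (none x) })
... | inj₁ (w , Pw , max) | no ¬P0 = inj₁ (fs w , Pw , λ { fz P0 → contradiction P0 ¬P0 ; (fs x) Px → max x Px })
... | inj₁ (w , Pw , max) | yes P0 with ≤-<-connex (f (fs w)) (f fz)
...   | inj₁ fw≤f0 = inj₁ (fz , P0 , λ { fz _ → ≤-refl ; (fs x) Px → ≤-trans (max x Px) fw≤f0 })
...   | inj₂ f0<fw = inj₁ (fs w , Pw , λ { fz _ → <⇒≤ f0<fw ; (fs x) Px → max x Px })

module WhipColouring {n : ℕ} (G T : Graph n) (r : Fin n)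
  (G-simple : IsSimple G) (spanning : IsSpanningTree G T) (normal : IsNormal G T r)
  (no-secant : ¬ HasSecant G T r) (whip : IsWhip T r) where

  T-simple : IsSimple T
  T-simple = IsSpanningTree.simple spanning

  T-sym : ∀ x y → T x y ≡ true → T y x ≡ true
  T-sym = IsSimple.sym T-simple

  open TreePaths T-simple (IsSpanningTree.acyclic spanning)

  path : ∀ x → Path T r x
  path x = IsSpanningTree.connected spanning r x

  level : Fin n → ℕ
  level x = Path.len (path x)

  c : Fin n
  c = proj₁ whip

  node-degree : 2 < degree T c
  node-degree = proj₁ (proj₁ (proj₂ whip))

  only-node : ∀ x → 2 < degree T x → x ≡ c
  only-node = proj₂ (proj₁ (proj₂ whip))

  successor-leaf : ∀ y → Successor T r c y → IsLeaf T r y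
  successor-leaf = proj₂ (proj₂ whip)

  spine : Path T r c
  spine = path c

  m : ℕ
  m = level c

  along : ∀ {b} (Q : Path T r b) {i x} → i ≤ Path.len Q → at Q i ≡ x →
    i ≡ level x × (∀ {t} → t ≤ i → at Q t ≡ at (path x) t)
  along Q i≤ Qi≡x = paths-agree Q (path _) i≤ ≤-refl (trans Qi≡x (sym (at-end (path _))))

  fork-is-node : ∀ {b b′} (P : Path T r b) (Q : Path T r b′) {d} → 0 < d → d < Path.len P → d < Path.len Q →
    at P d ≡ at Q d → at P (suc d) ≢ at Q (suc d) → at P d ≡ c
  fork-is-node P Q 0<d d<P d<Q Pd≡Qd diverge = only-node _ (fork⇒3≤degree P Q 0<d d<P d<Q Pd≡Qd diverge)

  OnSpine ChildOfNode OnBranch : Fin n → Set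
  OnSpine x = level x ≤ m × at spine (level x) ≡ x
  ChildOfNode x = level x ≡ suc m × at (path x) m ≡ c
  OnBranch x = ¬ OnSpine x × ¬ ChildOfNode x

  on-spine? : Decidable OnSpine
  on-spine? x = level x ≤? m ×-dec at spine (level x) ≟ x

  child-of-node? : Decidable ChildOfNode
  child-of-node? x = level x ℕ.≟ suc m ×-dec at (path x) m ≟ c

  on-branch? : Decidable OnBranch
  on-branch? x = ¬? (on-spine? x) ×-dec ¬? (child-of-node? x)

  on-spine : ∀ {t x} → t ≤ m → at spine t ≡ x → OnSpine x
  on-spine t≤m spine-t≡x with along spine t≤m spine-t≡x
  ... | refl , _ = t≤m , spine-t≡x

  node-on-path : ∀ {x t} → t ≤ level x → at (path x) t ≡ c → OnSpine x ⊎ ChildOfNode x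
  node-on-path {x} t≤ at-node with along (path x) t≤ at-node
  ... | refl , _ with m≤n⇒m<n∨m≡n t≤
  ...   | inj₂ m≡level = inj₁ (on-spine ≤-refl (trans (at-end spine) (trans (sym at-node)
                                 (trans (cong (at (path x)) m≡level) (at-end (path x))))))
  ...   | inj₁ m<level with m≤n⇒m<n∨m≡n m<level
  ...     | inj₂ 1+m≡level = inj₂ (sym 1+m≡level , at-node)
  ...     | inj₁ 1+m<level = ⊥-elim (<-irrefl (sym degree≡1) (interior⇒2≤degree T-sym (path x) (s≤s z≤n) 1+m<level))
    where
    y : Fin n
    y = at (path x) (suc m)
    degree≡1 : degree T y ≡ 1
    degree≡1 = proj₂ (successor-leaf y
      ( subst (λ u → T u y ≡ true) at-node (at-adjacent (path x) m<level)
      , m , (spine , refl) , (prefix (path x) (suc m) m<level , refl)))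

  branch-avoids-node : ∀ {x t} → OnBranch x → t ≤ level x → at (path x) t ≢ c
  branch-avoids-node (not-spine , not-child) t≤ at-node with node-on-path t≤ at-node
  ... | inj₁ spine = not-spine spine
  ... | inj₂ child = not-child child

  branch-off-spine : ∀ {x d} → OnBranch x → d ≤ level x → d ≤ m → at (path x) d ≡ at spine d → d < level x × d < m
  branch-off-spine {x} branch d≤x d≤m Pd≡Sd =
      ≤∧≢⇒< d≤x (λ { refl → proj₁ branch (on-spine d≤m (trans (sym Pd≡Sd) (at-end (path x)))) })
    , ≤∧≢⇒< d≤m (λ { refl → branch-avoids-node branch d≤x (trans Pd≡Sd (at-end spine)) })

  branch-leaves-root : ∀ {x} → OnBranch x →
    0 < m × 0 < level x × (∀ {s} → s ≤ m → at (path x) 1 ≢ at spine s)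
  branch-leaves-root {x} branch with divergence (path x) spine
  ... | zero , 0≤x , 0≤m , P0≡S0 , off-spine with branch-off-spine branch 0≤x 0≤m P0≡S0
  ...   | 0<x , 0<m = 0<m , 0<x , off-spine (s≤s z≤n) 0<x
  branch-leaves-root {x} branch | suc d , d≤x , d≤m , Pd≡Sd , off-spine with branch-off-spine branch d≤x d≤m Pd≡Sd
  ...   | d<x , d<m = ⊥-elim (branch-avoids-node branch d≤x
          (fork-is-node (path x) spine (s≤s z≤n) d<x d<m Pd≡Sd (off-spine (n<1+n (suc d)) d<x d<m)))

  _≺_ : Fin n → Fin n → Set
  x ≺ y = level x < level y × at (path y) (level x) ≡ x

  G-loopless : ∀ {x} → G x x ≢ true
  G-loopless {x} Gxx with trans (sym Gxx) (IsSimple.irrefl G-simple x)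
  ... | ()

  edge-to-descendant : ∀ {x y} → G x y ≡ true → x ≤[ T , r ] y → x ≺ y
  edge-to-descendant {x} {y} Gxy (Q , i , Qi≡x) = ≤∧≢⇒< x≤y distinct , on-path
    where
    i≤Q : toℕ i ≤ Path.len Q
    i≤Q = ≤-pred (toℕ<n i)
    Qi≡x′ : at Q (toℕ i) ≡ x
    Qi≡x′ = trans (at-toℕ Q i) Qi≡x
    Q≈y : Path.len Q ≡ level y × (∀ {t} → t ≤ Path.len Q → at Q t ≡ at (path y) t)
    Q≈y = along Q ≤-refl (at-end Q)
    i≡x : toℕ i ≡ level x
    i≡x = proj₁ (along Q i≤Q Qi≡x′)
    x≤y : level x ≤ level y
    x≤y = subst₂ _≤_ i≡x (proj₁ Q≈y) i≤Q
    on-path : at (path y) (level x) ≡ x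
    on-path = subst (λ k → at (path y) k ≡ x) i≡x (trans (sym (proj₂ Q≈y i≤Q)) Qi≡x′)
    distinct : level x ≢ level y
    distinct eq = G-loopless (subst (λ u → G u y ≡ true)
      (trans (sym on-path) (trans (cong (at (path y)) eq) (at-end (path y)))) Gxy)

  no-crossing-chords : ∀ {b} (P : Path T r b) {l p q s} → l < p → p < q → q < s → suc l < q → s ≤ Path.len P →
    G (at P l) (at P q) ≡ true → G (at P p) (at P s) ≡ true → ⊥
  no-crossing-chords {b} P {l} {p} {q} {s} l<p p<q q<s 1+l<q s≤L Glq Gps =
    no-secant (b , P , clamp L l , clamp L q , clamp L p , clamp L s , Glq , Gps ,
      subst₂ _<_ (sym ⟦l⟧) (sym ⟦q⟧) (<-trans l<p p<q) ,
      subst₂ _<_ (sym ⟦p⟧) (sym ⟦s⟧) (<-trans p<q q<s) ,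
      subst₂ (λ u v → suc u < v) (sym ⟦l⟧) (sym ⟦q⟧) 1+l<q ,
      subst₂ (λ u v → suc u < v) (sym ⟦p⟧) (sym ⟦s⟧) (<-≤-trans (s≤s p<q) q<s) ,
      inj₁ (subst₂ _<_ (sym ⟦l⟧) (sym ⟦p⟧) l<p , subst₂ _<_ (sym ⟦p⟧) (sym ⟦q⟧) p<q , subst₂ _<_ (sym ⟦q⟧) (sym ⟦s⟧) q<s))
    where
    L : ℕ
    L = Path.len P
    q≤L : q ≤ L
    q≤L = ≤-trans (<⇒≤ q<s) s≤L
    p≤L : p ≤ L
    p≤L = ≤-trans (<⇒≤ p<q) q≤L
    ⟦l⟧ : toℕ (clamp L l) ≡ l
    ⟦l⟧ = toℕ-clamp (≤-trans (<⇒≤ l<p) p≤L)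
    ⟦p⟧ : toℕ (clamp L p) ≡ p
    ⟦p⟧ = toℕ-clamp p≤L
    ⟦q⟧ : toℕ (clamp L q) ≡ q
    ⟦q⟧ = toℕ-clamp q≤L
    ⟦s⟧ : toℕ (clamp L s) ≡ s
    ⟦s⟧ = toℕ-clamp s≤L

  child-path : ∀ {y} → ChildOfNode y → ∀ {t} → t ≤ m → at (path y) t ≡ at spine t
  child-path (level≡1+m , at-node) = proj₂ (along (path _) (subst (m ≤_) (sym level≡1+m) (n≤1+n m)) at-node)

  -- The children of the node are merged into the single point suc m after the node.
  SpineChord : ℕ → ℕ → Set
  SpineChord i j = (j ≤ m × G (at spine i) (at spine j) ≡ true)
                 ⊎ (j ≡ suc m × ∃ λ y → ChildOfNode y × G (at spine i) y ≡ true)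

  spine-chord? : ∀ i j → Dec (SpineChord i j)
  spine-chord? i j = (j ≤? m ×-dec G (at spine i) (at spine j) Bool.≟ true)
              ⊎-dec (j ℕ.≟ suc m ×-dec any? (λ y → child-of-node? y ×-dec G (at spine i) y Bool.≟ true))

  spine-noncrossing : NonCrossing SpineChord
  spine-noncrossing l<p p<q q<s 1+l<q Hlq (inj₁ (s≤m , Gps)) =
    no-crossing-chords spine l<p p<q q<s 1+l<q s≤m (lower-chord Hlq (<⇒≤ (<-≤-trans q<s s≤m))) Gps
    where
    lower-chord : ∀ {l q} → SpineChord l q → q ≤ m → G (at spine l) (at spine q) ≡ true
    lower-chord (inj₁ (_ , G-lq)) _ = G-lq
    lower-chord (inj₂ (refl , _)) 1+m≤m = contradiction 1+m≤m (<-irrefl refl)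
  spine-noncrossing {l} {p} {q} l<p p<q q<s 1+l<q Hlq (inj₂ (refl , y , child , Gpy)) =
    no-crossing-chords (path y) l<p p<q q<s 1+l<q (≤-reflexive (sym (proj₁ child)))
      (subst₂ (λ u v → G u v ≡ true) (sym (child-path child l≤m)) (sym (child-path child q≤m)) (lower-chord Hlq))
      (subst₂ (λ u v → G u v ≡ true) (sym (child-path child p≤m)) (sym y-end) Gpy)
    where
    q≤m : q ≤ m
    q≤m = ≤-pred q<s
    p≤m : p ≤ m
    p≤m = ≤-trans (<⇒≤ p<q) q≤m
    l≤m : l ≤ m
    l≤m = ≤-trans (<⇒≤ l<p) p≤m
    y-end : at (path y) (suc m) ≡ y
    y-end = trans (cong (at (path y)) (sym (proj₁ child))) (at-end (path y))
    lower-chord : SpineChord l q → G (at spine l) (at spine q) ≡ true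
    lower-chord (inj₁ (_ , G-lq)) = G-lq
    lower-chord (inj₂ (refl , _)) = contradiction q<s (<-irrefl refl)

  spine-colouring : Σ (ℕ → Fin 3) λ col → col 0 ≡ fz × col (suc m) ≡ fs fz × ProperOn SpineChord col 0 (suc m)
  spine-colouring = colour-segment spine-chord? spine-noncrossing (s≤s z≤n) λ ()

  first-step : ∀ {b} (P : Path T r b) → 0 < Path.len P → T r (at P 1) ≡ true
  first-step P 0<L = subst (λ u → T u (at P 1) ≡ true) (at-start P) (at-adjacent P 0<L)

  ancestor-of-branch : ∀ {x y} → OnBranch y → x ≺ y → level x ≡ 0 ⊎ OnBranch x
  ancestor-of-branch {x} {y} y-branch (x<y , y-at-x≡x) with level x ℕ.≟ 0
  ... | yes x≡0 = inj₁ x≡0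
  ... | no x≢0 = inj₂ (not-spine , not-child)
    where
    y≈x : ∀ {t} → t ≤ level x → at (path y) t ≡ at (path x) t
    y≈x = proj₂ (along (path y) (<⇒≤ x<y) y-at-x≡x)
    1≤x : 1 ≤ level x
    1≤x = n≢0⇒n>0 x≢0
    not-spine : ¬ OnSpine x
    not-spine (x≤m , spine-x≡x) = proj₂ (proj₂ (branch-leaves-root y-branch)) (≤-trans 1≤x x≤m)
      (trans (y≈x 1≤x) (sym (proj₂ (along spine x≤m spine-x≡x) 1≤x)))
    not-child : ¬ ChildOfNode x
    not-child (x≡1+m , x-at-m≡c) = branch-avoids-node y-branch m≤y (trans (y≈x m≤x) x-at-m≡c)
      where
      m≤x : m ≤ level x
      m≤x = subst (m ≤_) (sym x≡1+m) (n≤1+n m)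
      m≤y : m ≤ level y
      m≤y = ≤-trans m≤x (<⇒≤ x<y)

  branches-do-not-fork : ∀ {x y d} → OnBranch x → OnBranch y → d < level x → d < level y →
    at (path x) d ≡ at (path y) d → at (path x) (suc d) ≢ at (path y) (suc d) → ⊥
  branches-do-not-fork {x} {y} {zero} x-branch y-branch 0<x 0<y _ apart =
    branch-avoids-node x-branch z≤n (trans (at-start (path x)) (only-node r root-fork))
    where
    x-root : 0 < m × 0 < level x × (∀ {s} → s ≤ m → at (path x) 1 ≢ at spine s)
    x-root = branch-leaves-root x-branch
    y-root : 0 < m × 0 < level y × (∀ {s} → s ≤ m → at (path y) 1 ≢ at spine s)
    y-root = branch-leaves-root y-branch
    -- at the root, the spine supplies the third neighbour
    root-fork : 2 < degree T r
    root-fork = three-neighbours⇒3≤degree T apart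
      (proj₂ (proj₂ x-root) (proj₁ x-root)) (proj₂ (proj₂ y-root) (proj₁ y-root))
      (first-step (path x) 0<x) (first-step (path y) 0<y) (first-step spine (proj₁ x-root))
  branches-do-not-fork {x} {y} {suc d} x-branch _ d<x d<y Pd≡Qd apart =
    branch-avoids-node x-branch (<⇒≤ d<x) (fork-is-node (path x) (path y) (s≤s z≤n) d<x d<y Pd≡Qd apart)

  BranchColouring : (ℕ → Fin 3) → Set
  BranchColouring col = col 0 ≡ fz
    × (∀ {x y} → OnBranch y → x ≺ y → G x y ≡ true → col (level x) ≢ col (level y))
    × (∀ {x} → OnBranch x → IsLeaf T r x → col (level x) ≡ fs fz)

  module Deepest (w : Fin n) (w-branch : OnBranch w) (deepest : ∀ x → OnBranch x → level x ≤ level w) where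

    on-deepest : ∀ {x} → OnBranch x → at (path w) (level x) ≡ x
    on-deepest {x} x-branch with divergence (path x) (path w)
    ... | d , d≤x , d≤w , Pd≡Wd , off-W with m≤n⇒m<n∨m≡n d≤x
    ...   | inj₂ refl = trans (sym Pd≡Wd) (at-end (path x))
    ...   | inj₁ d<x = ⊥-elim (branches-do-not-fork x-branch w-branch d<x d<w Pd≡Wd (off-W (n<1+n d) d<x d<w))
      where
      d<w : d < level w
      d<w = ≤∧≢⇒< d≤w (λ d≡w → <-irrefl refl (<-≤-trans (subst (_< level x) d≡w d<x) (deepest x x-branch)))

    BranchChord : ℕ → ℕ → Set
    BranchChord i j = j ≤ level w × G (at (path w) i) (at (path w) j) ≡ true

    branch-chord? : ∀ i j → Dec (BranchChord i j)
    branch-chord? i j = j ≤? level w ×-dec G (at (path w) i) (at (path w) j) Bool.≟ true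

    branch-noncrossing : NonCrossing BranchChord
    branch-noncrossing l<p p<q q<s 1+l<q (_ , Glq) (s≤w , Gps) =
      no-crossing-chords (path w) l<p p<q q<s 1+l<q s≤w Glq Gps

    colouring : Σ (ℕ → Fin 3) BranchColouring
    colouring with colour-segment branch-chord? branch-noncrossing (proj₁ (proj₂ (branch-leaves-root w-branch))) {fz} {fs fz} (λ ())
    ... | col , col-root , col-end , proper = col , col-root , proper′ , leaves
      where
      proper′ : ∀ {x y} → OnBranch y → x ≺ y → G x y ≡ true → col (level x) ≢ col (level y)
      proper′ {x} {y} y-branch (x<y , y-at-x≡x) Gxy = proper z≤n x<y y≤w
        (y≤w , subst₂ (λ u v → G u v ≡ true) (sym w-at-x≡x) (sym (on-deepest y-branch)) Gxy)
        where
        y≤w : level y ≤ level w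
        y≤w = deepest y y-branch
        w-at-x≡x : at (path w) (level x) ≡ x
        w-at-x≡x = trans (proj₂ (along (path w) y≤w (on-deepest y-branch)) (<⇒≤ x<y)) y-at-x≡x
      leaves : ∀ {x} → OnBranch x → IsLeaf T r x → col (level x) ≡ fs fz
      leaves {x} x-branch (_ , degree≡1) with m≤n⇒m<n∨m≡n (deepest x x-branch)
      ... | inj₂ x≡w = trans (cong col x≡w) col-end
      ... | inj₁ x<w = ⊥-elim (<-irrefl (sym degree≡1) (subst (λ u → 2 ≤ degree T u) (on-deepest x-branch)
                         (interior⇒2≤degree T-sym (path w) (proj₁ (proj₂ (branch-leaves-root x-branch))) x<w)))

  branch-colouring : Σ (ℕ → Fin 3) BranchColouring
  branch-colouring with maximum? on-branch? level
  ... | inj₁ (w , w-branch , deepest) = Deepest.colouring w w-branch deepest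
  ... | inj₂ none = (λ _ → fz) , refl , (λ y-branch → ⊥-elim (none _ y-branch)) , (λ x-branch → ⊥-elim (none _ x-branch))

  spine-col : ℕ → Fin 3
  spine-col = proj₁ spine-colouring

  spine-col-proper : ProperOn SpineChord spine-col 0 (suc m)
  spine-col-proper = proj₂ (proj₂ (proj₂ spine-colouring))

  branch-col : ℕ → Fin 3
  branch-col = proj₁ branch-colouring

  colour : Fin n → Fin 3
  colour x with on-spine? x | child-of-node? x
  ... | yes _ | _ = spine-col (level x)
  ... | no _ | yes _ = fs fz
  ... | no _ | no _ = branch-col (level x)

  colour-on-spine : ∀ {x} → OnSpine x → colour x ≡ spine-col (level x)
  colour-on-spine {x} x-spine with on-spine? x
  ... | yes _ = refl
  ... | no ¬x-spine = contradiction x-spine ¬x-spine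

  colour-on-branch : ∀ {x} → OnBranch x → colour x ≡ branch-col (level x)
  colour-on-branch {x} (¬x-spine , ¬x-child) with on-spine? x | child-of-node? x
  ... | yes x-spine | _ = contradiction x-spine ¬x-spine
  ... | no _ | yes x-child = contradiction x-child ¬x-child
  ... | no _ | no _ = refl

  colour-ancestor-of-branch : ∀ {x y} → OnBranch y → x ≺ y → colour x ≡ branch-col (level x)
  colour-ancestor-of-branch {x} y-branch x≺y with ancestor-of-branch y-branch x≺y
  ... | inj₂ x-branch = colour-on-branch x-branch
  ... | inj₁ x≡0 = begin
    colour x             ≡⟨ colour-on-spine (on-spine z≤n (trans (at-start spine) r≡x)) ⟩
    spine-col (level x)  ≡⟨ cong spine-col x≡0 ⟩
    spine-col 0          ≡⟨ proj₁ (proj₂ spine-colouring) ⟩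
    fz                   ≡⟨ sym (proj₁ (proj₂ branch-colouring)) ⟩
    branch-col 0         ≡⟨ cong branch-col (sym x≡0) ⟩
    branch-col (level x) ∎
    where
    open ≡-Reasoning
    r≡x : r ≡ x
    r≡x = trans (sym (at-start (path x))) (trans (cong (at (path x)) (sym x≡0)) (at-end (path x)))

  descendant-edge : ∀ {x y} → x ≺ y → G x y ≡ true → colour x ≢ colour y
  descendant-edge {x} {y} (x<y , y-at-x≡x) Gxy with on-spine? y | child-of-node? y
  ... | yes (y≤m , spine-y≡y) | _ =
        subst (_≢ spine-col (level y)) (sym (colour-on-spine (x≤m , spine-x≡x)))
          (spine-col-proper z≤n x<y (m≤n⇒m≤1+n y≤m)
            (inj₁ (y≤m , subst₂ (λ u v → G u v ≡ true) (sym spine-x≡x) (sym spine-y≡y) Gxy)))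
    where
    x≤m : level x ≤ m
    x≤m = <⇒≤ (<-≤-trans x<y y≤m)
    spine-x≡x : at spine (level x) ≡ x
    spine-x≡x = trans (proj₂ (along spine y≤m spine-y≡y) (<⇒≤ x<y)) y-at-x≡x
  ... | no _ | yes y-child =
        subst₂ _≢_ (sym (colour-on-spine (x≤m , spine-x≡x))) (proj₁ (proj₂ (proj₂ spine-colouring)))
          (spine-col-proper z≤n x<1+m ≤-refl (inj₂ (refl , y , y-child , subst (λ u → G u y ≡ true) (sym spine-x≡x) Gxy)))
    where
    x<1+m : level x < suc m
    x<1+m = subst (level x <_) (proj₁ y-child) x<y
    x≤m : level x ≤ m
    x≤m = ≤-pred x<1+m
    spine-x≡x : at spine (level x) ≡ x
    spine-x≡x = trans (sym (child-path y-child x≤m)) y-at-x≡x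
  ... | no ¬y-spine | no ¬y-child =
        subst (_≢ branch-col (level y)) (sym (colour-ancestor-of-branch (¬y-spine , ¬y-child) (x<y , y-at-x≡x)))
          (proj₁ (proj₂ (proj₂ branch-colouring)) (¬y-spine , ¬y-child) (x<y , y-at-x≡x) Gxy)

  proper : IsProper3Coloring G colour
  proper x y Gxy with normal x y Gxy
  ... | inj₁ x≤y = descendant-edge (edge-to-descendant Gxy x≤y) Gxy
  ... | inj₂ y≤x = λ same → descendant-edge (edge-to-descendant Gyx y≤x) Gyx (sym same)
    where
    Gyx : G y x ≡ true
    Gyx = IsSimple.sym G-simple x y Gxy

  spine-not-leaf : ∀ {x} → OnSpine x → ¬ IsLeaf T r x
  spine-not-leaf {x} (x≤m , spine-x≡x) (x≢r , degree≡1) with level x ℕ.≟ 0 | m≤n⇒m<n∨m≡n x≤m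
  ... | yes x≡0 | _ = x≢r (trans (sym spine-x≡x) (trans (cong (at spine) x≡0) (at-start spine)))
  ... | no _ | inj₂ x≡m = <-irrefl (sym degree≡1) (<-trans (s≤s (s≤s z≤n))
        (subst (λ u → 2 < degree T u) (trans (sym (at-end spine)) (trans (cong (at spine) (sym x≡m)) spine-x≡x))
          node-degree))
  ... | no x≢0 | inj₁ x<m = <-irrefl (sym degree≡1)
        (subst (λ u → 2 ≤ degree T u) spine-x≡x (interior⇒2≤degree T-sym spine (n≢0⇒n>0 x≢0) x<m))

  leaves-coloured : ∀ x → IsLeaf T r x → colour x ≡ fs fz
  leaves-coloured x x-leaf with on-spine? x | child-of-node? x
  ... | yes x-spine | _ = contradiction x-leaf (spine-not-leaf x-spine)
  ... | no _ | yes _ = refl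
  ... | no ¬x-spine | no ¬x-child = proj₂ (proj₂ (proj₂ branch-colouring)) (¬x-spine , ¬x-child) x-leaf

mainTheorem9 : (n : ℕ) (G T : Graph n) (r : Fin n) →
    IsSimple G → IsSpanningTree G T → IsNormal G T r → ¬ HasSecant G T r →
    IsWhip T r →
    Σ (Fin n → Fin 3) λ col → IsProper3Coloring G col ×
      Σ (Fin 3) λ k → (∀ x → IsLeaf T r x → col x ≡ k)
mainTheorem9 n G T r G-simple spanning normal no-secant whip =
  colour , proper , fs fz , leaves-coloured
  where open WhipColouring G T r G-simple spanning normal no-secant whip
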